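{- Every bipartite graph is a Zykov graph.
   Context: Zykov's construction: $Z_1$ is the graph with one vertex. Given $Z_1,\dots,Z_k$ ($k\ge 1$), the graph $Z_{k+1}$ is obtained by taking the disjoint union of $Z_1,\dots,Z_k$ and, for each $k$-tuple $(v_1,\dots,v_k)$ with $v_i\in V(Z_i)$, adding a new vertex adjacent exactly to $v_1,\dots,v_k$. A Zykov graph is any graph isomorphic to an induced subgraph of $Z_k$ for some integer $k\ge 1$. -}

module Defs where

open import Data.Nat using (ℕ)
open import Data.Fin using (Fin; toℕ)
open import Data.Bool using (Bool)
open import Data.Product using (Σ; _×_; ∃-syntax)
open import Relation.Nullary using (¬_; Dec)
open import Relation.Binary.PropositionalEquality using (_≡_; _≢_)
open import Function.Bundles using (_⇔_)
open import Function.Definitions using (Injective)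

record Graph : Set₁ where
  field
    n       : ℕ
    Adj     : Fin n → Fin n → Set
    adj?    : ∀ x y → Dec (Adj x y)
    symm    : ∀ {x y} → Adj x y → Adj y x
    irrefl  : ∀ {x} → ¬ Adj x x

Bipartite : Graph → Set
Bipartite G = Σ (Fin (Graph.n G) → Bool) λ c →
  ∀ {x y} → Graph.Adj G x y → c x ≢ c y

-- ZV k is the vertex set of Z_{k+1}:
-- Z_{k+1} is the disjoint union of Z_1,…,Z_k (component i : Fin k is Z_{i+1},
-- i.e. ZV (toℕ i)) together with one new vertex for each k-tuple
-- (v_1,…,v_k), v_i ∈ V(Z_i).  For k = 0 this gives Z_1 = one vertex
-- (the empty tuple), matching the definition.
data ZV : ℕ → Set where
  old : ∀ {k} (i : Fin k) → ZV (toℕ i) → ZV k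
  new : ∀ {k} → ((i : Fin k) → ZV (toℕ i)) → ZV k

data ZAdj : ∀ {k} → ZV k → ZV k → Set where
  inside : ∀ {k} (i : Fin k) {u v : ZV (toℕ i)} → ZAdj u v → ZAdj {k} (old i u) (old i v)
  down   : ∀ {k} (t : (i : Fin k) → ZV (toℕ i)) (i : Fin k) → ZAdj {k} (new t) (old i (t i))
  up     : ∀ {k} (t : (i : Fin k) → ZV (toℕ i)) (i : Fin k) → ZAdj {k} (old i (t i)) (new t)

InducedIn : (G : Graph) (k : ℕ) → Set
InducedIn G k = Σ (Fin (Graph.n G) → ZV k) λ f →
  Injective _≡_ _≡_ f × (∀ x y → Graph.Adj G x y ⇔ ZAdj (f x) (f y))

-- A Zykov graph: isomorphic to an induced subgraph of Z_m for some m ≥ 1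
-- (here m = k + 1, k : ℕ).
Zykov : Graph → Set
Zykov G = ∃[ k ] InducedIn G k

-- Put one colour class A of G into old copies and the other, B, onto new
-- vertices of Z_{n+2}, n = |V(G)|.  Vertex x ∈ A becomes a fixed vertex of
-- copy number x of Z_{x+2}; vertex y ∈ B becomes the new vertex whose tuple
-- picks, in copy x, that same vertex exactly when x = y or x ~ y, and a
-- different one otherwise.  Then x ~ y iff the images are adjacent, and the
-- "x = y" entries make the tuples of distinct vertices of B differ.
module Submission where

open import Defs
open import Level using (0ℓ)
open import Data.Nat using (zero; suc)
open import Data.Fin using (Fin; toℕ; zero; suc)
open import Data.Fin.Properties using (_≟_)
open import Data.Bool using (Bool; true; false)
open import Data.Product using (_,_)
open import Data.Sum using (_⊎_; inj₁; inj₂)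
open import Data.Empty using (⊥-elim)
open import Relation.Nullary using (¬_; Dec; yes; no)
open import Relation.Nullary.Decidable using (_⊎-dec_)
open import Relation.Binary.PropositionalEquality
  using (_≡_; _≢_; refl; sym; trans; cong-app)
open import Function.Bundles using (_⇔_; mk⇔; Equivalence)
open import Function.Properties.Equivalence using (⇔-setoid) renaming (sym to ⇔-sym)
open import Relation.Binary.Reasoning.Setoid (⇔-setoid 0ℓ)

⇔-of-¬ : {A B : Set} → ¬ A → ¬ B → A ⇔ B
⇔-of-¬ ¬a ¬b = mk⇔ (λ a → ⊥-elim (¬a a)) (λ b → ⊥-elim (¬b b))

⊎-⇔-of-¬ˡ : {A B : Set} → ¬ A → (A ⊎ B) ⇔ B
⊎-⇔-of-¬ˡ ¬a = mk⇔ (λ { (inj₁ a) → ⊥-elim (¬a a) ; (inj₂ b) → b }) inj₂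

≡-sym-⇔ : {A : Set} {u v : A} → u ≡ v ⇔ v ≡ u
≡-sym-⇔ = mk⇔ sym sym

ZAdj-irrefl : ∀ {k} {u : ZV k} → ¬ ZAdj u u
ZAdj-irrefl (inside i a) = ZAdj-irrefl a

ZAdj-sym : ∀ {k} {u v : ZV k} → ZAdj u v → ZAdj v u
ZAdj-sym (inside i a) = inside i (ZAdj-sym a)
ZAdj-sym (down t i)   = up t i
ZAdj-sym (up t i)     = down t i

ZAdj-sym-⇔ : ∀ {k} {u v : ZV k} → ZAdj u v ⇔ ZAdj v u
ZAdj-sym-⇔ = mk⇔ ZAdj-sym ZAdj-sym

old-new-adj⇔ : ∀ {k} {i : Fin k} {u t} → ZAdj {k} (old i u) (new t) ⇔ u ≡ t i
old-new-adj⇔ = mk⇔ (λ { (up t i) → refl }) (λ { refl → up _ _ })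

new-new-¬adj : ∀ {k} {t s} → ¬ ZAdj {k} (new t) (new s)
new-new-¬adj ()

new-injective : ∀ {k} {t s : (i : Fin k) → ZV (toℕ i)} → new t ≡ new s → t ≡ s
new-injective refl = refl

vertex : ∀ k → ZV k
vertex zero    = new (λ ())
vertex (suc k) = old zero (vertex zero)

marked unmarked : ∀ {m} → ZV (suc m)
marked   = old zero (vertex zero)
unmarked = new (λ i → vertex (toℕ i))

mark : ∀ {m} {P : Set} → Dec P → ZV (suc m)
mark (yes _) = marked
mark (no _)  = unmarked

mark≡marked⇔ : ∀ {m} {P : Set} (d : Dec P) → mark {m} d ≡ marked ⇔ P
mark≡marked⇔ (yes p) = mk⇔ (λ _ → p) (λ _ → refl)
mark≡marked⇔ (no ¬p) = mk⇔ (λ ()) (λ p → ⊥-elim (¬p p))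

marked-copies-¬adj : ∀ {n} {i j : Fin n} →
                     ¬ ZAdj {suc n} (old (suc i) marked) (old (suc j) marked)
marked-copies-¬adj (inside _ a) = ZAdj-irrefl a

module Embedding (G : Graph) (colour : Fin (Graph.n G) → Bool)
                 (proper : ∀ {x y} → Graph.Adj G x y → colour x ≢ colour y) where
  open Graph G

  signature : Fin n → (i : Fin (suc n)) → ZV (toℕ i)
  signature y zero    = vertex zero
  signature y (suc x) = mark (x ≟ y ⊎-dec adj? x y)

  place : Fin n → Bool → ZV (suc n)
  place x true  = old (suc x) marked
  place x false = new (signature x)

  embed : Fin n → ZV (suc n)
  embed x = place x (colour x)

  signature≡marked⇔ : ∀ x y → signature y (suc x) ≡ marked ⇔ (x ≡ y ⊎ Adj x y)
  signature≡marked⇔ x y = mark≡marked⇔ (x ≟ y ⊎-dec adj? x y)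

  coloured-apart : ∀ {x y b b′} → colour x ≡ b → colour y ≡ b′ → b ≢ b′ → x ≢ y
  coloured-apart refl refl b≢b′ refl = b≢b′ refl

  old-new-adj⇔Adj : ∀ {x y} → x ≢ y →
                    ZAdj (old (suc x) marked) (new (signature y)) ⇔ Adj x y
  old-new-adj⇔Adj {x} {y} x≢y = begin
    ZAdj (old (suc x) marked) (new (signature y)) ≈⟨ old-new-adj⇔ ⟩
    marked ≡ signature y (suc x)                  ≈⟨ ≡-sym-⇔ ⟩
    signature y (suc x) ≡ marked                  ≈⟨ signature≡marked⇔ x y ⟩
    (x ≡ y ⊎ Adj x y)                             ≈⟨ ⊎-⇔-of-¬ˡ x≢y ⟩
    Adj x y                                       ∎

  same-colour-¬Adj : ∀ {x y b} → colour x ≡ b → colour y ≡ b → ¬ Adj x y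
  same-colour-¬Adj refl cy a = proper a (sym cy)

  place-Adj⇔ : ∀ x y {b b′} → colour x ≡ b → colour y ≡ b′ →
               Adj x y ⇔ ZAdj (place x b) (place y b′)
  place-Adj⇔ x y {true}  {true}  cx cy =
    ⇔-of-¬ (same-colour-¬Adj cx cy) marked-copies-¬adj
  place-Adj⇔ x y {false} {false} cx cy =
    ⇔-of-¬ (same-colour-¬Adj cx cy) new-new-¬adj
  place-Adj⇔ x y {true}  {false} cx cy =
    ⇔-sym (old-new-adj⇔Adj (coloured-apart cx cy λ ()))
  place-Adj⇔ x y {false} {true}  cx cy = begin
    Adj x y                                       ≈⟨ mk⇔ symm symm ⟩
    Adj y x                                       ≈⟨ old-new-adj⇔Adj (coloured-apart cy cx λ ()) ⟨
    ZAdj (old (suc y) marked) (new (signature x)) ≈⟨ ZAdj-sym-⇔ ⟩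
    ZAdj (new (signature x)) (old (suc y) marked) ∎

  signature-injective : ∀ {x y} → colour x ≡ colour y →
                        signature x ≡ signature y → x ≡ y
  signature-injective {x} {y} cx≡cy sx≡sy
    with Equivalence.to (signature≡marked⇔ x y)
           (trans (sym (cong-app sx≡sy (suc x)))
                  (Equivalence.from (signature≡marked⇔ x x) (inj₁ refl)))
  ... | inj₁ x≡y = x≡y
  ... | inj₂ a   = ⊥-elim (proper a cx≡cy)

  place-injective : ∀ x y {b b′} → colour x ≡ b → colour y ≡ b′ →
                    place x b ≡ place y b′ → x ≡ y
  place-injective x y {true}  {true}  cx cy refl = refl
  place-injective x y {false} {false} cx cy e    =
    signature-injective (trans cx (sym cy)) (new-injective e)

  embed-induced : InducedIn G (suc n)
  embed-induced =
      embed
    , (λ {x} {y} → place-injective x y refl refl)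
    , (λ x y → place-Adj⇔ x y refl refl)

lemma7 : (G : Graph) → Bipartite G → Zykov G
lemma7 G (colour , proper) = suc (Graph.n G) , Embedding.embed-induced G colour proper
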